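{- Let $r\geq 2$ be an integer and $\delta>0$. Let $G$ be an $(X,Y)$-bipartite graph with $|X|=m$, $|Y|=n$ and $m\leq n$, and set $\alpha=\frac{m+n}{r^2n}\delta$ and $\beta=\frac{m+n}{r^2m}\delta$. If $e(G)\geq (1-\delta)\frac{mn}{r}$, then one of the following holds: (i) $G$ contains a double star (as a subgraph) on at least $\frac{m+n}{r}$ vertices; (ii) (a) for all but at most $\alpha^{1/3}m$ exceptional vertices $x\in X$ we have $\deg(x) > \underline{\deg}(X,Y) - \alpha^{1/3} n$, and (b) for all but at most $\beta^{1/3}n$ exceptional vertices $y\in Y$ we have $\deg(y) > \underline{\deg}(Y,X) - \beta^{1/3} m$.
   Context: $e(G)$ is the number of edges of $G$. A double star is a tree obtained by joining the centers of two vertex-disjoint stars by an edge. For an $(X,Y)$-bipartite graph, $\underline{\deg}(X,Y)=\sum_{v\in X}\deg(v)/|X|$ is the average degree of vertices of $X$, and $\underline{\deg}(Y,X)=\sum_{v\in Y}\deg(v)/|Y|$ is the average degree of vertices of $Y$.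
   Formalization: The parameter δ ranges over the positive rationals. -}

module Defs where

open import Data.Nat using (ℕ; zero; suc)
open import Data.Bool using (Bool; true)
open import Data.Fin using (Fin)
open import Data.Fin.Subset using (Subset; ∣_∣)
open import Data.Vec using (tabulate)
open import Data.Vec as Vec using ()
open import Data.Integer using (+_)
open import Data.Rational using (ℚ; 0ℚ; _/_; _*_; _≤_; _<_)
open import Data.Sum using (_⊎_)

-- An (X,Y)-bipartite graph with X = Fin m and Y = Fin n is given by its
-- (decidable) bipartite adjacency relation  E x y = true  iff  xy is an edge.
BipGraph : ℕ → ℕ → Set
BipGraph m n = Fin m → Fin n → Bool

ℕ→ℚ : ℕ → ℚ
ℕ→ℚ k = + k / 1

-- division of a rational by a natural number (only used with d ≥ 1;
-- the value for d = 0 is an irrelevant junk value 0)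
_/ℕ_ : ℚ → ℕ → ℚ
q /ℕ zero = 0ℚ
q /ℕ suc d = q * (+ 1 / suc d)

module _ {m n : ℕ} (G : BipGraph m n) where

  NX : Fin m → Subset n
  NX x = tabulate (G x)

  NY : Fin n → Subset m
  NY y = tabulate (λ x → G x y)

  degX : Fin m → ℕ
  degX x = ∣ NX x ∣

  degY : Fin n → ℕ
  degY y = ∣ NY y ∣

  -- e(G): number of edges (each edge has exactly one end in X)
  e : ℕ
  e = Vec.sum (tabulate degX)

  avgDegX : ℚ
  avgDegX = ℕ→ℚ (Vec.sum (tabulate degX)) /ℕ m

  avgDegY : ℚ
  avgDegY = ℕ→ℚ (Vec.sum (tabulate degY)) /ℕ n

-- Comparisons with a cube root of a nonnegative rational a:
--   q ≤ a^{1/3}  iff  q ≤ 0 or q³ ≤ a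
--   q < a^{1/3}  iff  q < 0 or q³ < a
_≤∛_ : ℚ → ℚ → Set
q ≤∛ a = (q ≤ 0ℚ) ⊎ (q * q * q ≤ a)

_<∛_ : ℚ → ℚ → Set
q <∛ a = (q < 0ℚ) ⊎ (q * q * q < a)

module Submission where

-- Call an edge xy heavy if r (deg x + deg y) ≥ m + n.  A heavy edge is the
-- centre edge of a double star whose leaves are the remaining neighbours of
-- x and y, so it has deg x + deg y ≥ (m + n)/r vertices: alternative (i).
-- Otherwise every edge is light and, summing over the edges,
--   r (Σ_x deg(x)² + Σ_y deg(y)²) ≤ e(G) (m + n).
-- Together with Cauchy–Schwarz e(G)² ≤ n Σ_y deg(y)² and the density bound
-- (1 - δ) m n ≤ r e(G), an explicit certificate shows that the variance
-- Σ_x (deg(X,Y) - deg x)² is at most α m n², where α r² n = (m + n) δ.  A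
-- cube-root Chebyshev inequality then gives at most (α m³)^{1/3} exceptional
-- vertices x with deg(X,Y) - deg x ≥ (α n³)^{1/3}: this is (ii)(a).  The
-- argument only uses the two degree sequences, so (ii)(b) is the same lemma
-- with the roles of X and Y exchanged.

open import Defs

module Development where

  open import Data.Nat as ℕ using (ℕ; zero; suc)
  import Data.Nat.Properties as ℕ
  import Data.Nat.Coprimality as Coprime
  import Data.Integer as ℤ
  import Data.Integer.Properties as ℤ
  open import Data.Rational
    using (ℚ; mkℚ; _/_; 0ℚ; 1ℚ; _+_; _*_; _-_; -_; _≤_; _<_; *≤*; positive; nonNegative; nonPositive)
  open import Data.Rational.Properties
  open import Data.Rational.Solver using (module +-*-Solver)
  open +-*-Solver using (solve; _:+_; _:*_; _:-_; _:=_; con)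
  open import Algebra.Bundles using (CommutativeRing)
  open import Algebra.Properties.Semiring.Sum (CommutativeRing.semiring +-*-commutativeRing)
    using (sum; sum-syntax; sum-cong-≗; ∑-distrib-+; ∑-comm; *-distribˡ-sum; *-distribʳ-sum; sum-replicate-zero)
  open import Data.Bool using (Bool; true; false; not)
  open import Data.Bool.Properties using () renaming (_≟_ to _≟ᵇ_)
  open import Data.Fin using (Fin; zero; suc)
  open import Data.Fin.Properties using (any?)
  open import Data.Fin.Subset using (Subset; ∣_∣; _∈_; _∉_; inside; outside; _∩_; ∁; ⁅_⁆) renaming (⊥ to ∅)
  open import Data.Fin.Subset.Properties using (∩-identityʳ; x∈p∩q⁻; x∈∁p⇒x∉p; x∉⁅y⁆⇒x≢y)
  open import Data.Vec as Vec using (tabulate; _∷_)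
  open import Data.Vec.Properties using (lookup∘tabulate; lookup⇒[]=; []=⇒lookup; map-replicate)
  open import Data.Product using (Σ; _×_; _,_; ∃-syntax; proj₁; proj₂)
  open import Data.Sum using (_⊎_; inj₁; inj₂; [_,_]′)
  open import Relation.Nullary using (Dec; yes; no; does; contradiction)
  open import Relation.Nullary.Decidable using (_×-dec_; dec-true)
  open import Relation.Binary.PropositionalEquality

  -- ι k is the rational k.  On a variable k the normalising division in
  -- ℕ→ℚ does not compute, so the arithmetic of ι goes through its normal form.
  ι : ℕ → ℚ
  ι = ℕ→ℚ

  ι-normal : ∀ k → ι k ≡ mkℚ (ℤ.+ k) 0 (Coprime.sym (Coprime.1-coprimeTo k))
  ι-normal k = normalize-coprime _

  ι-+ : ∀ a b → ι (a ℕ.+ b) ≡ ι a + ι b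
  ι-+ a b = trans (cong (_/ 1) numerator) (sym (cong₂ _+_ (ι-normal a) (ι-normal b)))
    where
    numerator : ℤ.+ (a ℕ.+ b) ≡ ℤ.+ a ℤ.* ℤ.+ 1 ℤ.+ ℤ.+ b ℤ.* ℤ.+ 1
    numerator = trans (ℤ.pos-+ a b) (sym (cong₂ ℤ._+_ (ℤ.*-identityʳ (ℤ.+ a)) (ℤ.*-identityʳ (ℤ.+ b))))

  ι-* : ∀ a b → ι (a ℕ.* b) ≡ ι a * ι b
  ι-* a b = trans (cong (_/ 1) (ℤ.pos-* a b)) (sym (cong₂ _*_ (ι-normal a) (ι-normal b)))

  ι-cube : ∀ k → ι (k ℕ.* k ℕ.* k) ≡ ι k * ι k * ι k
  ι-cube k = trans (ι-* (k ℕ.* k) k) (cong (_* ι k) (ι-* k k))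

  ι-mono : ∀ {a b} → a ℕ.≤ b → ι a ≤ ι b
  ι-mono {a} {b} a≤b = subst₂ _≤_ (sym (ι-normal a)) (sym (ι-normal b))
    (*≤* (subst₂ ℤ._≤_ (sym (ℤ.*-identityʳ (ℤ.+ a))) (sym (ℤ.*-identityʳ (ℤ.+ b))) (ℤ.+≤+ a≤b)))

  ι-nonneg : ∀ k → 0ℚ ≤ ι k
  ι-nonneg k = ι-mono {0} {k} ℕ.z≤n

  ι-pos : ∀ {k} → 1 ℕ.≤ k → 0ℚ < ι k
  ι-pos {suc k} _ rewrite ι-normal (suc k) = positive⁻¹ (mkℚ (ℤ.+ suc k) 0 _)

  /ℕ-cancel : ∀ {d} → 1 ℕ.≤ d → ∀ q → (q /ℕ d) * ι d ≡ q
  /ℕ-cancel {suc k} _ q = trans (*-assoc q _ _) (trans (cong (q *_) inverse) (*-identityʳ q))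
    where
    inverse : (ℤ.+ 1 / suc k) * ι (suc k) ≡ 1ℚ
    inverse = trans (cong₂ _*_ (normalize-coprime (Coprime.1-coprimeTo (suc k))) (ι-normal (suc k)))
                    (*-inverseˡ (mkℚ (ℤ.+ suc k) 0 (Coprime.sym (Coprime.1-coprimeTo (suc k)))))

  /ℕ-≤ : ∀ {d} → 1 ℕ.≤ d → ∀ {q p} → q ≤ p * ι d → q /ℕ d ≤ p
  /ℕ-≤ {d} d≥1 {q} {p} h =
    *-cancelʳ-≤-pos (ι d) {{positive (ι-pos d≥1)}} (subst (_≤ p * ι d) (sym (/ℕ-cancel d≥1 q)) h)

  ≤-/ℕ : ∀ {d} → 1 ℕ.≤ d → ∀ {q p} → q /ℕ d ≤ p → q ≤ p * ι d
  ≤-/ℕ {d} d≥1 {q} {p} h =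
    subst (_≤ p * ι d) (/ℕ-cancel d≥1 q) (*-monoʳ-≤-nonNeg (ι d) {{nonNegative (ι-nonneg d)}} h)

  *-nonneg : ∀ {p q} → 0ℚ ≤ p → 0ℚ ≤ q → 0ℚ ≤ p * q
  *-nonneg {p} {q} p≥0 q≥0 = nonNegative⁻¹ (p * q) {{nonNeg*nonNeg⇒nonNeg p {{nonNegative p≥0}} q {{nonNegative q≥0}}}}

  *-pos : ∀ {p q} → 0ℚ < p → 0ℚ < q → 0ℚ < p * q
  *-pos {p} {q} p>0 q>0 = positive⁻¹ (p * q) {{pos*pos⇒pos p {{positive p>0}} q {{positive q>0}}}}

  pos-factor : ∀ {p q} → 0ℚ < q → 0ℚ < p * q → 0ℚ < p
  pos-factor {p} {q} q>0 pq>0 =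
    *-cancelʳ-<-nonNeg q {{nonNegative (<⇒≤ q>0)}} (subst (_< p * q) (sym (*-zeroˡ q)) pq>0)

  nonneg-cancelˡ : ∀ {c p} → 0ℚ < c → 0ℚ ≤ c * p → 0ℚ ≤ p
  nonneg-cancelˡ {c} {p} c>0 h = *-cancelˡ-≤-pos c {{positive c>0}} (subst (_≤ c * p) (sym (*-zeroʳ c)) h)

  square-nonneg : ∀ p → 0ℚ ≤ p * p
  square-nonneg p with ≤-total 0ℚ p
  ... | inj₁ p≥0 = *-nonneg p≥0 p≥0
  ... | inj₂ p≤0 = nonNegative⁻¹ (p * p) {{nonPos*nonPos⇒nonPos p {{nonPositive p≤0}} p {{nonPositive p≤0}}}}

  ≤⇒0≤- : ∀ {p q} → p ≤ q → 0ℚ ≤ q - p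
  ≤⇒0≤- {p} {q} p≤q = subst (_≤ q - p) (+-inverseʳ p) (+-monoˡ-≤ (- p) p≤q)

  0≤-⇒≤ : ∀ {p q} → 0ℚ ≤ q - p → p ≤ q
  0≤-⇒≤ {p} {q} h = subst₂ _≤_ (+-identityˡ p) (solve 2 (λ p q → q :- p :+ p := q) refl p q) (+-monoˡ-≤ p h)

  square-mono : ∀ {p q} → 0ℚ ≤ p → p ≤ q → p * p ≤ q * q
  square-mono {p} {q} p≥0 p≤q =
    ≤-trans (*-monoˡ-≤-nonNeg p {{nonNegative p≥0}} p≤q) (*-monoʳ-≤-nonNeg q {{nonNegative (≤-trans p≥0 p≤q)}} p≤q)

  cube-mono : ∀ {p q} → 0ℚ ≤ p → p ≤ q → p * p * p ≤ q * q * q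
  cube-mono {p} {q} p≥0 p≤q =
    ≤-trans (*-monoˡ-≤-nonNeg (p * p) {{nonNegative (square-nonneg p)}} p≤q)
            (*-monoʳ-≤-nonNeg q {{nonNegative (≤-trans p≥0 p≤q)}} (square-mono p≥0 p≤q))

  ∑-mono : ∀ {k} {f g : Fin k → ℚ} → (∀ i → f i ≤ g i) → sum f ≤ sum g
  ∑-mono {zero} f≤g = ≤-refl
  ∑-mono {suc k} f≤g = +-mono-≤ (f≤g zero) (∑-mono (λ i → f≤g (suc i)))

  ∑-nonneg : ∀ {k} {f : Fin k → ℚ} → (∀ i → 0ℚ ≤ f i) → 0ℚ ≤ sum f
  ∑-nonneg {k} {f} f≥0 = subst (_≤ sum f) (sum-replicate-zero k) (∑-mono {f = λ _ → 0ℚ} f≥0)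

  ι-vecsum : ∀ {k} (f : Fin k → ℕ) → ι (Vec.sum (tabulate f)) ≡ sum (λ i → ι (f i))
  ι-vecsum {zero} f = refl
  ι-vecsum {suc k} f = trans (ι-+ (f zero) _) (cong (λ s → ι (f zero) + s) (ι-vecsum (λ i → f (suc i))))

  χ : Bool → ℚ
  χ true = 1ℚ
  χ false = 0ℚ

  ι-count : ∀ {k} (b : Fin k → Bool) → ι ∣ tabulate b ∣ ≡ sum (λ i → χ (b i))
  ι-count {zero} b = refl
  ι-count {suc k} b with b zero
  ... | true = trans (ι-+ 1 ∣ tabulate (λ i → b (suc i)) ∣) (cong (λ s → 1ℚ + s) (ι-count (λ i → b (suc i))))
  ... | false = trans (ι-count (λ i → b (suc i))) (sym (+-identityˡ (sum (λ i → χ (b (suc i))))))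

  count-none : ∀ {k} (b : Fin k → Bool) → (∀ x → b x ≡ false) → ι ∣ tabulate b ∣ ≡ 0ℚ
  count-none {k} b none = trans (ι-count b) (trans (sum-cong-≗ (λ x → cong χ (none x))) (sum-replicate-zero k))

  ∈-tabulate⁻ : ∀ {k} {b : Fin k → Bool} {x} → x ∈ tabulate b → b x ≡ true
  ∈-tabulate⁻ {b = b} {x} x∈ = trans (sym (lookup∘tabulate b x)) ([]=⇒lookup x∈)

  ∈-tabulate⁺ : ∀ {k} {b : Fin k → Bool} {x} → b x ≡ true → x ∈ tabulate b
  ∈-tabulate⁺ {b = b} {x} bx = lookup⇒[]= x (tabulate b) (trans (lookup∘tabulate b x) bx)

  dec-witness : ∀ {A : Set} (d : Dec A) → does d ≡ true → A
  dec-witness (yes a) _ = a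

  sum-of-squared-deviations : ∀ {k} (f : Fin k → ℚ) A →
    ∑[ i < k ] ((A - f i) * (A - f i)) ≡ ι k * (A * A) - (A + A) * sum f + ∑[ i < k ] (f i * f i)
  sum-of-squared-deviations {zero} f A =
    solve 1 (λ A → con 0ℚ := con 0ℚ :* (A :* A) :- (A :+ A) :* con 0ℚ :+ con 0ℚ) refl A
  sum-of-squared-deviations {suc k} f A = begin
      (A - x) * (A - x) + ∑[ i < k ] ((A - f (suc i)) * (A - f (suc i)))
    ≡⟨ cong ((A - x) * (A - x) +_) (sum-of-squared-deviations (λ i → f (suc i)) A) ⟩
      (A - x) * (A - x) + (ι k * (A * A) - (A + A) * s + t)
    ≡⟨ solve 5 (λ A x K s t → (A :- x) :* (A :- x) :+ (K :* (A :* A) :- (A :+ A) :* s :+ t)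
                            := (con 1ℚ :+ K) :* (A :* A) :- (A :+ A) :* (x :+ s) :+ (x :* x :+ t)) refl A x (ι k) s t ⟩
      (1ℚ + ι k) * (A * A) - (A + A) * (x + s) + (x * x + t)
    ≡⟨ cong (λ c → c * (A * A) - (A + A) * (x + s) + (x * x + t)) (sym (ι-+ 1 k)) ⟩
      ι (suc k) * (A * A) - (A + A) * (x + s) + (x * x + t)
    ∎
    where
    open ≡-Reasoning
    x = f zero
    s = ∑[ i < k ] f (suc i)
    t = ∑[ i < k ] (f (suc i) * f (suc i))

  variance : ∀ {k} (f : Fin k → ℚ) A → A * ι k ≡ sum f →
    ∑[ i < k ] ((A - f i) * (A - f i)) ≡ ∑[ i < k ] (f i * f i) - sum f * A
  variance {k} f A mean = begin
      ∑[ i < k ] ((A - f i) * (A - f i))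
    ≡⟨ sum-of-squared-deviations f A ⟩
      ι k * (A * A) - (A + A) * sum f + sq
    ≡⟨ cong (λ s → ι k * (A * A) - (A + A) * s + sq) (sym mean) ⟩
      ι k * (A * A) - (A + A) * (A * ι k) + sq
    ≡⟨ solve 3 (λ K A sq → K :* (A :* A) :- (A :+ A) :* (A :* K) :+ sq := sq :- (A :* K) :* A) refl (ι k) A sq ⟩
      sq - (A * ι k) * A
    ≡⟨ cong (λ s → sq - s * A) mean ⟩
      sq - sum f * A
    ∎
    where
    open ≡-Reasoning
    sq = ∑[ i < k ] (f i * f i)

  -- Cauchy–Schwarz (Σ f)² ≤ k Σ f², from the nonnegativity of the variance
  cauchy-schwarz : ∀ {k} (f : Fin k → ℚ) A → A * ι k ≡ sum f → sum f * sum f ≤ ι k * ∑[ i < k ] (f i * f i)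
  cauchy-schwarz {k} f A mean = 0≤-⇒≤ (subst (0ℚ ≤_) rearrange (*-nonneg (ι-nonneg k) variance≥0))
    where
    sq = ∑[ i < k ] (f i * f i)
    variance≥0 : 0ℚ ≤ sq - sum f * A
    variance≥0 = subst (0ℚ ≤_) (variance f A mean) (∑-nonneg (λ i → square-nonneg (A - f i)))
    rearrange : ι k * (sq - sum f * A) ≡ ι k * sq - sum f * sum f
    rearrange = trans (solve 4 (λ K sq s A → K :* (sq :- s :* A) := K :* sq :- s :* (A :* K)) refl (ι k) sq (sum f) A)
                      (cong (λ s → ι k * sq - sum f * s) mean)

  -- Read E as e(G), SX, SY as Σ deg(x)², Σ deg(y)².  The
  -- facts  R (SX + SY) ≤ E (M + N)  (light edges),  E² ≤ N SY
  -- (Cauchy–Schwarz) and  (1 - δ) M N ≤ R E  (density) bound M SX - E², which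
  -- is M times the variance of the X-degrees, by a M² N² when
  -- a R² N = (M + N) δ.  R² N times the slack equals a nonnegative
  -- combination of the hypotheses and of the square (M N - R E)².
  variance-bound : ∀ (M N R E SX SY δ a : ℚ) → 0ℚ ≤ M → 0ℚ < N → 0ℚ < R →
    R * (SX + SY) ≤ E * (M + N) → E * E ≤ N * SY → (1ℚ - δ) * (M * N) ≤ R * E →
    a * (R * R * N) ≡ (M + N) * δ →
    M * SX - E * E ≤ a * (M * M * (N * N))
  variance-bound M N R E SX SY δ a M≥0 N>0 R>0 light cs dense a-def =
    0≤-⇒≤ (nonneg-cancelˡ (*-pos (*-pos R>0 R>0) N>0) (subst (0ℚ ≤_) (sym slack≡certificate) certificate≥0))
    where
    open ≡-Reasoning
    P = M * N
    certificate = (M + N) * (P * (R * E - (1ℚ - δ) * P) + (P - R * E) * (P - R * E))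
                + R * R * M * (N * SY - E * E) + R * N * M * (E * (M + N) - R * (SX + SY))
    slack≡certificate : R * R * N * (a * (M * M * (N * N)) - (M * SX - E * E)) ≡ certificate
    slack≡certificate = begin
        R * R * N * (a * (M * M * (N * N)) - (M * SX - E * E))
      ≡⟨ solve 6 (λ R N a M SX E → R :* R :* N :* (a :* (M :* M :* (N :* N)) :- (M :* SX :- E :* E))
                := (a :* (R :* R :* N)) :* (M :* M :* (N :* N)) :- R :* R :* N :* (M :* SX :- E :* E)) refl R N a M SX E ⟩
        (a * (R * R * N)) * (M * M * (N * N)) - R * R * N * (M * SX - E * E)
      ≡⟨ cong (λ c → c * (M * M * (N * N)) - R * R * N * (M * SX - E * E)) a-def ⟩
        ((M + N) * δ) * (M * M * (N * N)) - R * R * N * (M * SX - E * E)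
      ≡⟨ solve 7 (λ M N R δ E SX SY → ((M :+ N) :* δ) :* (M :* M :* (N :* N)) :- R :* R :* N :* (M :* SX :- E :* E)
            := (M :+ N) :* ((M :* N) :* (R :* E :- (con 1ℚ :- δ) :* (M :* N)) :+ (M :* N :- R :* E) :* (M :* N :- R :* E))
                :+ R :* R :* M :* (N :* SY :- E :* E) :+ R :* N :* M :* (E :* (M :+ N) :- R :* (SX :+ SY))) refl M N R δ E SX SY ⟩
        certificate
      ∎
    N≥0 = <⇒≤ N>0
    R≥0 = <⇒≤ R>0
    certificate≥0 : 0ℚ ≤ certificate
    certificate≥0 =
      +-mono-≤ (+-mono-≤ (*-nonneg (+-mono-≤ M≥0 N≥0) (+-mono-≤ (*-nonneg (*-nonneg M≥0 N≥0) (≤⇒0≤- dense))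
                                                               (square-nonneg (P - R * E))))
                         (*-nonneg (*-nonneg (*-nonneg R≥0 R≥0) M≥0) (≤⇒0≤- cs)))
               (*-nonneg (*-nonneg (*-nonneg R≥0 N≥0) M≥0) (≤⇒0≤- light))

  least : ∀ {k} (b : Fin k → Bool) (f : Fin k → ℚ) →
    (∀ x → b x ≡ false) ⊎ ∃[ x₀ ] (b x₀ ≡ true × ∀ x → b x ≡ true → f x₀ ≤ f x)
  least {zero} b f = inj₁ (λ ())
  least {suc k} b f with least (λ i → b (suc i)) (λ i → f (suc i)) | b zero in b₀
  ... | inj₁ none | false = inj₁ λ { zero → b₀ ; (suc i) → none i }
  ... | inj₁ none | true =
    inj₂ (zero , b₀ , λ { zero _ → ≤-refl ; (suc i) bi → contradiction (trans (sym bi) (none i)) λ () })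
  ... | inj₂ (x₀ , bx₀ , min) | false =
    inj₂ (suc x₀ , bx₀ , λ { zero bz → contradiction (trans (sym bz) b₀) λ () ; (suc i) bi → min i bi })
  ... | inj₂ (x₀ , bx₀ , min) | true with f zero ≤? f (suc x₀)
  ...   | yes f₀≤ = inj₂ (zero , b₀ , λ { zero _ → ≤-refl ; (suc i) bi → ≤-trans f₀≤ (min i bi) })
  ...   | no f₀≰ = inj₂ (suc x₀ , bx₀ , λ { zero _ → <⇒≤ (≰⇒> f₀≰) ; (suc i) bi → min i bi })

  markov : ∀ {k} (b : Fin k → Bool) (q : Fin k → ℚ) {t} → 0ℚ ≤ t → (∀ x → b x ≡ true → t ≤ q x) →
    ι ∣ tabulate b ∣ * (t * t) ≤ ∑[ x < k ] (q x * q x)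
  markov {k} b q {t} t≥0 above = begin
    ι ∣ tabulate b ∣ * (t * t)       ≡⟨ cong (_* (t * t)) (ι-count b) ⟩
    sum (λ x → χ (b x)) * (t * t)    ≡⟨ *-distribʳ-sum (t * t) (λ x → χ (b x)) ⟩
    ∑[ x < k ] (χ (b x) * (t * t))   ≤⟨ ∑-mono term ⟩
    ∑[ x < k ] (q x * q x)           ∎
    where
    open ≤-Reasoning
    term : ∀ x → χ (b x) * (t * t) ≤ q x * q x
    term x with b x in bx
    ... | true = subst (_≤ q x * q x) (sym (*-identityˡ (t * t))) (square-mono t≥0 (above x bx))
    ... | false = subst (_≤ q x * q x) (sym (*-zeroˡ (t * t))) (square-nonneg (q x))

  cubed-markov : ∀ {s t c V} → 0ℚ ≤ s → 0ℚ ≤ t → 0ℚ ≤ c → c ≤ t * t * t → s * (t * t) ≤ V →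
    s * s * s * (c * c) ≤ V * V * V
  cubed-markov {s} {t} {c} {V} s≥0 t≥0 c≥0 c≤t³ st²≤V = begin
    s * s * s * (c * c)                            ≤⟨ *-monoˡ-≤-nonNeg (s * s * s) {{nonNegative s³≥0}} (square-mono c≥0 c≤t³) ⟩
    s * s * s * (t * t * t * (t * t * t))          ≡⟨ regroup s t ⟩
    s * (t * t) * (s * (t * t)) * (s * (t * t))    ≤⟨ cube-mono (*-nonneg s≥0 (square-nonneg t)) st²≤V ⟩
    V * V * V                                      ∎
    where
    open ≤-Reasoning
    s³≥0 : 0ℚ ≤ s * s * s
    s³≥0 = *-nonneg (*-nonneg s≥0 s≥0) s≥0
    regroup : ∀ s t → s * s * s * (t * t * t * (t * t * t)) ≡ s * (t * t) * (s * (t * t)) * (s * (t * t))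
    regroup = solve 2 (λ s t → s :* s :* s :* (t :* t :* t :* (t :* t :* t))
                            := s :* (t :* t) :* (s :* (t :* t)) :* (s :* (t :* t))) refl

  -- S is the set
  -- where q x ≥ 0 and q x³ ≥ a N³; with t its minimal value of q, Markov
  -- gives |S| t² ≤ a M N², hence |S|³ (a N³)² ≤ (a M N²)³.
  cube-root-chebyshev : ∀ {k} (q : Fin k → ℚ) (a M N : ℚ) → 0ℚ < a → 0ℚ < N →
    ∑[ x < k ] (q x * q x) ≤ a * (M * (N * N)) →
    Σ (Subset k) λ S → (ι ∣ S ∣ ≤∛ (a * (M * M * M))) × (∀ x → x ∉ S → q x <∛ (a * (N * N * N)))
  cube-root-chebyshev {k} q a M N a>0 N>0 sum≤ = S , size , off-S
    where
    c = a * (N * N * N)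
    c>0 : 0ℚ < c
    c>0 = *-pos a>0 (*-pos (*-pos N>0 N>0) N>0)
    large? : ∀ x → Dec ((0ℚ ≤ q x) × (c ≤ q x * q x * q x))
    large? x = (0ℚ ≤? q x) ×-dec (c ≤? q x * q x * q x)
    b : Fin k → Bool
    b x = does (large? x)
    S = tabulate b

    off-S : ∀ x → x ∉ S → q x <∛ c
    off-S x x∉S with 0ℚ ≤? q x
    ... | no q≱0 = inj₁ (≰⇒> q≱0)
    ... | yes q≥0 = inj₂ (≰⇒> (λ c≤q³ → x∉S (∈-tabulate⁺ (dec-true (large? x) (q≥0 , c≤q³)))))

    -- the case split is an eliminator rather than 'with': abstracting the
    -- goal over ι ∣ S ∣ is very slow
    size : ι ∣ S ∣ ≤∛ (a * (M * M * M))
    size = [ (λ none → inj₁ (≤-reflexive (count-none b none))) ,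
             (λ (x₀ , bx₀ , minimal) → inj₂ (bound x₀ bx₀ minimal)) ]′ (least b q)
      where
      s = ι ∣ S ∣
      V = a * (M * (N * N))
      regroup : ∀ a M N → a * (M * (N * N)) * (a * (M * (N * N))) * (a * (M * (N * N)))
                        ≡ a * (M * M * M) * (a * (N * N * N) * (a * (N * N * N)))
      regroup = solve 3 (λ a M N → (a :* (M :* (N :* N))) :* (a :* (M :* (N :* N))) :* (a :* (M :* (N :* N)))
                                := a :* (M :* M :* M) :* ((a :* (N :* N :* N)) :* (a :* (N :* N :* N)))) refl
      bound : ∀ x₀ → b x₀ ≡ true → (∀ x → b x ≡ true → q x₀ ≤ q x) → s * s * s ≤ a * (M * M * M)
      bound x₀ bx₀ minimal = *-cancelʳ-≤-pos (c * c) {{positive (*-pos c>0 c>0)}} (begin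
        s * s * s * (c * c)        ≤⟨ cubed-markov (ι-nonneg ∣ S ∣) t≥0 (<⇒≤ c>0) c≤t³
                                                   (≤-trans (markov b q t≥0 minimal) sum≤) ⟩
        V * V * V                  ≡⟨ regroup a M N ⟩
        a * (M * M * M) * (c * c)  ∎)
        where
        open ≤-Reasoning
        t≥0 = proj₁ (dec-witness (large? x₀) bx₀)
        c≤t³ = proj₂ (dec-witness (large? x₀) bx₀)

  -- Degree sequences, abstractly: for d : Fin k → ℕ its total, its sum of
  -- squares and its mean, as rationals.  The mean is written exactly as the
  -- average degrees of Defs unfold.
  total squares : ∀ {k} → (Fin k → ℕ) → ℚ
  total d = sum (λ i → ι (d i))
  squares d = sum (λ i → ι (d i) * ι (d i))

  mean : ∀ {k} → (Fin k → ℕ) → ℚ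
  mean {k} d = ι (Vec.sum (tabulate d)) /ℕ k

  mean-total : ∀ {k} (d : Fin k → ℕ) → 1 ℕ.≤ k → mean d * ι k ≡ total d
  mean-total {k} d k≥1 = trans (/ℕ-cancel k≥1 _) (ι-vecsum d)

  concentrated-degrees : ∀ {k l} (dx : Fin k → ℕ) (dy : Fin l → ℕ) {r} → 1 ℕ.≤ r → 1 ℕ.≤ k → 1 ℕ.≤ l →
    ∀ δ → 0ℚ < δ → ∀ a → a * ι (r ℕ.* r ℕ.* l) ≡ ι (k ℕ.+ l) * δ →
    (1ℚ - δ) * ι (k ℕ.* l) ≤ ι (Vec.sum (tabulate dx)) * ι r →
    total dx ≡ total dy →
    ι r * (squares dx + squares dy) ≤ total dx * (ι k + ι l) →
    Σ (Subset k) λ S → (ι ∣ S ∣ ≤∛ (a * ι (k ℕ.* k ℕ.* k)))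
                     × (∀ i → i ∉ S → (mean dx - ι (dx i)) <∛ (a * ι (l ℕ.* l ℕ.* l)))
  concentrated-degrees {k} {l} dx dy {r} r≥1 k≥1 l≥1 δ δ>0 a a-def dense same-total light =
    S , subst (λ K → ι ∣ S ∣ ≤∛ (a * K)) (sym (ι-cube k)) few ,
    λ i i∉S → subst (λ L → (A - ι (dx i)) <∛ (a * L)) (sym (ι-cube l)) (close i i∉S)
    where
    M = ι k
    N = ι l
    R = ι r
    E = total dx
    A = mean dx
    N>0 = ι-pos l≥1
    R>0 = ι-pos r≥1
    a-def′ : a * (R * R * N) ≡ (M + N) * δ
    a-def′ = trans (cong (a *_) (sym (trans (ι-* (r ℕ.* r) l) (cong (_* N) (ι-* r r)))))
                   (trans a-def (cong (_* δ) (ι-+ k l)))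
    a>0 : 0ℚ < a
    a>0 = pos-factor (*-pos (*-pos R>0 R>0) N>0) (subst (0ℚ <_) (sym a-def′) (*-pos (+-mono-< (ι-pos k≥1) N>0) δ>0))
    dense′ : (1ℚ - δ) * (M * N) ≤ R * E
    dense′ = subst₂ _≤_ (cong ((1ℚ - δ) *_) (ι-* k l)) (trans (*-comm _ R) (cong (R *_) (ι-vecsum dx))) dense
    cs : E * E ≤ N * squares dy
    cs = subst (λ s → s * s ≤ N * squares dy) (sym same-total)
               (cauchy-schwarz (λ j → ι (dy j)) (mean dy) (mean-total dy l≥1))
    bound : M * squares dx - E * E ≤ a * (M * M * (N * N))
    bound = variance-bound M N R E (squares dx) (squares dy) δ a (ι-nonneg k) N>0 R>0 light cs dense′ a-def′
    deviation-bound : ∑[ i < k ] ((A - ι (dx i)) * (A - ι (dx i))) ≤ a * (M * (N * N))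
    deviation-bound = *-cancelˡ-≤-pos M {{positive (ι-pos k≥1)}}
      (subst₂ _≤_ (sym scaled) (solve 3 (λ a M N → a :* (M :* M :* (N :* N)) := M :* (a :* (M :* (N :* N)))) refl a M N) bound)
      where
      scaled : M * ∑[ i < k ] ((A - ι (dx i)) * (A - ι (dx i))) ≡ M * squares dx - E * E
      scaled = trans (cong (M *_) (variance (λ i → ι (dx i)) A (mean-total dx k≥1)))
                     (trans (solve 4 (λ M S E A → M :* (S :- E :* A) := M :* S :- E :* (A :* M)) refl M (squares dx) E A)
                            (cong (λ c → M * squares dx - E * c) (mean-total dx k≥1)))
    chebyshev = cube-root-chebyshev (λ i → A - ι (dx i)) a M N a>0 N>0 deviation-bound
    S = proj₁ chebyshev
    few = proj₁ (proj₂ chebyshev)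
    close = proj₂ (proj₂ chebyshev)

  _without_ : ∀ {k} → Subset k → Fin k → Subset k
  p without x = p ∩ ∁ ⁅ x ⁆

  without-⊆ : ∀ {k} (p : Subset k) x {y} → y ∈ p without x → y ∈ p × y ≢ x
  without-⊆ p x y∈ with x∈p∩q⁻ p (∁ ⁅ x ⁆) y∈
  ... | y∈p , y∈∁x = y∈p , x∉⁅y⁆⇒x≢y (x∈∁p⇒x∉p y∈∁x)

  without-nothing : ∀ {k} (p : Subset k) → p ≡ p ∩ ∁ ∅
  without-nothing {k} p = trans (sym (∩-identityʳ p)) (cong (p ∩_) (sym (map-replicate not outside k)))

  without-size : ∀ {k} (p : Subset k) x → ∣ p ∣ ℕ.≤ suc ∣ p without x ∣
  without-size (inside ∷ p) zero = ℕ.s≤s (ℕ.≤-reflexive (cong ∣_∣ (without-nothing p)))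
  without-size (outside ∷ p) zero = ℕ.≤-trans (ℕ.≤-reflexive (cong ∣_∣ (without-nothing p))) (ℕ.n≤1+n _)
  without-size (inside ∷ p) (suc x) = ℕ.s≤s (without-size p x)
  without-size (outside ∷ p) (suc x) = without-size p x

  heavy-or-light : ∀ {m n} (G : BipGraph m n) r →
      (∃[ x ] ∃[ y ] (G x y ≡ true) × (m ℕ.+ n ℕ.≤ r ℕ.* (degX G x ℕ.+ degY G y)))
    ⊎ (∀ x y → G x y ≡ true → r ℕ.* (degX G x ℕ.+ degY G y) ℕ.< m ℕ.+ n)
  heavy-or-light {m} {n} G r
    with any? (λ x → any? (λ y → (G x y ≟ᵇ true) ×-dec (m ℕ.+ n ℕ.≤? r ℕ.* (degX G x ℕ.+ degY G y))))
  ... | yes heavy = inj₁ heavy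
  ... | no none = inj₂ λ x y xy → ℕ.≰⇒> λ heavy → none (x , y , xy , heavy)

  module _ {m n : ℕ} (G : BipGraph m n) where

    private
      dX : Fin m → ℚ
      dX x = ι (degX G x)

      dY : Fin n → ℚ
      dY y = ι (degY G y)

      dX-sum : ∀ x → dX x ≡ ∑[ y < n ] χ (G x y)
      dX-sum x = ι-count (G x)

      dY-sum : ∀ y → dY y ≡ ∑[ x < m ] χ (G x y)
      dY-sum y = ι-count (λ x → G x y)

    -- both sides count every edge once
    handshake : total (degX G) ≡ total (degY G)
    handshake = begin
      sum dX                            ≡⟨ sum-cong-≗ dX-sum ⟩
      ∑[ x < m ] ∑[ y < n ] χ (G x y)   ≡⟨ ∑-comm (λ x y → χ (G x y)) ⟩
      ∑[ y < n ] ∑[ x < m ] χ (G x y)   ≡⟨ sum-cong-≗ dY-sum ⟨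
      sum dY                            ∎
      where open ≡-Reasoning

    edges-from-Y : ι (Vec.sum (tabulate (degY G))) ≡ ι (e G)
    edges-from-Y = trans (ι-vecsum (degY G)) (trans (sym handshake) (sym (ι-vecsum (degX G))))

    edge-degree-sum : ∑[ x < m ] ∑[ y < n ] (χ (G x y) * (dX x + dY y)) ≡ squares (degX G) + squares (degY G)
    edge-degree-sum = begin
      ∑[ x < m ] ∑[ y < n ] (χ (G x y) * (dX x + dY y))
        ≡⟨ sum-cong-≗ (λ x → trans (sum-cong-≗ (λ y → *-distribˡ-+ (χ (G x y)) (dX x) (dY y)))
                                     (∑-distrib-+ (λ y → χ (G x y) * dX x) (λ y → χ (G x y) * dY y))) ⟩
      ∑[ x < m ] (∑[ y < n ] (χ (G x y) * dX x) + ∑[ y < n ] (χ (G x y) * dY y))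
        ≡⟨ ∑-distrib-+ (λ x → ∑[ y < n ] (χ (G x y) * dX x)) (λ x → ∑[ y < n ] (χ (G x y) * dY y)) ⟩
      ∑[ x < m ] ∑[ y < n ] (χ (G x y) * dX x) + ∑[ x < m ] ∑[ y < n ] (χ (G x y) * dY y)
        ≡⟨ cong₂ _+_ (sum-cong-≗ rowX) (∑-comm (λ x y → χ (G x y) * dY y)) ⟩
      squares (degX G) + ∑[ y < n ] ∑[ x < m ] (χ (G x y) * dY y)
        ≡⟨ cong (squares (degX G) +_) (sum-cong-≗ rowY) ⟩
      squares (degX G) + squares (degY G) ∎
      where
      open ≡-Reasoning
      rowX : ∀ x → ∑[ y < n ] (χ (G x y) * dX x) ≡ dX x * dX x
      rowX x = trans (sym (*-distribʳ-sum (dX x) (λ y → χ (G x y)))) (cong (_* dX x) (sym (dX-sum x)))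
      rowY : ∀ y → ∑[ x < m ] (χ (G x y) * dY y) ≡ dY y * dY y
      rowY y = trans (sym (*-distribʳ-sum (dY y) (λ x → χ (G x y)))) (cong (_* dY y) (sym (dY-sum y)))

    light-degree-sums : ∀ {r} → (∀ x y → G x y ≡ true → r ℕ.* (degX G x ℕ.+ degY G y) ℕ.< m ℕ.+ n) →
      ι r * (squares (degX G) + squares (degY G)) ≤ total (degX G) * (ι m + ι n)
    light-degree-sums {r} light = begin
      R * (squares (degX G) + squares (degY G))
        ≡⟨ cong (R *_) (sym edge-degree-sum) ⟩
      R * ∑[ x < m ] ∑[ y < n ] (χ (G x y) * (dX x + dY y))
        ≡⟨ trans (*-distribˡ-sum R (λ x → ∑[ y < n ] (χ (G x y) * (dX x + dY y))))
                 (sum-cong-≗ (λ x → *-distribˡ-sum R (λ y → χ (G x y) * (dX x + dY y)))) ⟩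
      ∑[ x < m ] ∑[ y < n ] (R * (χ (G x y) * (dX x + dY y)))
        ≤⟨ ∑-mono (λ x → ∑-mono (λ y → edge-term (G x y) (dX x + dY y) (light′ x y))) ⟩
      ∑[ x < m ] ∑[ y < n ] (χ (G x y) * K)
        ≡⟨ sum-cong-≗ (λ x → trans (sym (*-distribʳ-sum K (λ y → χ (G x y)))) (cong (_* K) (sym (dX-sum x)))) ⟩
      ∑[ x < m ] (dX x * K)
        ≡⟨ *-distribʳ-sum K dX ⟨
      sum dX * K ∎
      where
      open ≤-Reasoning
      R = ι r
      K = ι m + ι n
      light′ : ∀ x y → G x y ≡ true → R * (dX x + dY y) ≤ K
      light′ x y xy = subst₂ _≤_ (trans (ι-* r _) (cong (R *_) (ι-+ (degX G x) (degY G y)))) (ι-+ m n)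
                               (ι-mono (ℕ.<⇒≤ (light x y xy)))
      edge-term : ∀ b w → (b ≡ true → R * w ≤ K) → R * (χ b * w) ≤ χ b * K
      edge-term true w h = subst₂ _≤_ (cong (R *_) (sym (*-identityˡ w))) (sym (*-identityˡ K)) (h refl)
      edge-term false w h = subst₂ _≤_ (sym (trans (cong (R *_) (*-zeroˡ w)) (*-zeroʳ R))) (sym (*-zeroˡ K)) ≤-refl

    light-degree-sumsᵀ : ∀ {r} → (∀ x y → G x y ≡ true → r ℕ.* (degX G x ℕ.+ degY G y) ℕ.< m ℕ.+ n) →
      ι r * (squares (degY G) + squares (degX G)) ≤ total (degY G) * (ι n + ι m)
    light-degree-sumsᵀ {r} light =
      subst₂ (λ S T → ι r * S ≤ T) (+-comm (squares (degX G)) _) (cong₂ _*_ handshake (+-comm (ι m) (ι n)))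
             (light-degree-sums {r} light)

    double-star : ∀ {r} → 1 ℕ.≤ r → ∀ x y → G x y ≡ true → m ℕ.+ n ℕ.≤ r ℕ.* (degX G x ℕ.+ degY G y) →
      ∃[ x ] ∃[ y ] Σ (Subset n) λ LX → Σ (Subset m) λ LY →
          (G x y ≡ true)
        × (∀ y′ → y′ ∈ LX → (y′ ≢ y) × (G x y′ ≡ true))
        × (∀ x′ → x′ ∈ LY → (x′ ≢ x) × (G x′ y ≡ true))
        × (ι (m ℕ.+ n) /ℕ r ≤ ι (2 ℕ.+ ∣ LX ∣ ℕ.+ ∣ LY ∣))
    double-star {r} r≥1 x y xy heavy = x , y , LX , LY , xy , leafX , leafY , size
      where
      LX = NX G x without y
      LY = NY G y without x
      leafX : ∀ y′ → y′ ∈ LX → (y′ ≢ y) × (G x y′ ≡ true)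
      leafX y′ y′∈ with without-⊆ (NX G x) y y′∈
      ... | y′∈N , y′≢y = y′≢y , ∈-tabulate⁻ y′∈N
      leafY : ∀ x′ → x′ ∈ LY → (x′ ≢ x) × (G x′ y ≡ true)
      leafY x′ x′∈ with without-⊆ (NY G y) x x′∈
      ... | x′∈N , x′≢x = x′≢x , ∈-tabulate⁻ x′∈N
      vertices : m ℕ.+ n ℕ.≤ (2 ℕ.+ ∣ LX ∣ ℕ.+ ∣ LY ∣) ℕ.* r
      vertices = ℕ.≤-trans heavy (ℕ.≤-trans
        (ℕ.*-monoʳ-≤ r (ℕ.+-mono-≤ (without-size (NX G x) y) (without-size (NY G y) x)))
        (ℕ.≤-reflexive (trans (cong (r ℕ.*_) (cong suc (ℕ.+-suc ∣ LX ∣ ∣ LY ∣))) (ℕ.*-comm r _))))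
      size : ι (m ℕ.+ n) /ℕ r ≤ ι (2 ℕ.+ ∣ LX ∣ ℕ.+ ∣ LY ∣)
      size = /ℕ-≤ r≥1 (subst (ι (m ℕ.+ n) ≤_) (ι-* (2 ℕ.+ ∣ LX ∣ ℕ.+ ∣ LY ∣) r) (ι-mono vertices))

open import Data.Nat using (ℕ; _+_; _*_; _≤_)
open import Data.Bool using (true)
open import Data.Fin.Subset using (Subset; ∣_∣; _∈_; _∉_)
open import Data.Product using (Σ; _×_; ∃-syntax)
open import Data.Sum using (_⊎_)
open import Relation.Binary.PropositionalEquality using (_≡_; _≢_)
open import Data.Rational using (ℚ; 0ℚ; 1ℚ; _-_; _<_) renaming (_≤_ to _≤ℚ_; _*_ to _·_)

import Data.Nat.Properties as ℕ
open import Data.Product using (_,_; _,′_)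
open import Data.Sum using (inj₁; inj₂)
open import Function using (case_of_)
open import Relation.Binary.PropositionalEquality using (sym; trans; cong; subst₂)
open import Data.Vec as Vec using (tabulate)
open Development
  using (/ℕ-cancel; ≤-/ℕ; heavy-or-light; double-star; concentrated-degrees;
         handshake; edges-from-Y; light-degree-sums; light-degree-sumsᵀ)

lemma11 : (r : ℕ) → 2 ≤ r → (δ : ℚ) → 0ℚ < δ →
  (m n : ℕ) → 1 ≤ m → m ≤ n → (G : BipGraph m n) →
  ((1ℚ - δ) · ℕ→ℚ (m * n)) /ℕ r ≤ℚ ℕ→ℚ (e G) →
  -- (i) a double star with adjacent centres x ∈ X, y ∈ Y, leaf sets
  --     LX ⊆ N(x) ∖ {y} and LY ⊆ N(y) ∖ {x}, on at least (m+n)/r vertices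
  (∃[ x ] ∃[ y ] Σ (Subset n) λ LX → Σ (Subset m) λ LY →
      (G x y ≡ true)
    × (∀ y′ → y′ ∈ LX → (y′ ≢ y) × (G x y′ ≡ true))
    × (∀ x′ → x′ ∈ LY → (x′ ≢ x) × (G x′ y ≡ true))
    × (ℕ→ℚ (m + n) /ℕ r ≤ℚ ℕ→ℚ (2 + ∣ LX ∣ + ∣ LY ∣)))
  ⊎
  -- (ii) with α = (m+n)δ/(r²n), β = (m+n)δ/(r²m)
  ( -- (a) exceptional set S ⊆ X of size ≤ α^{1/3} m
    (Σ (Subset m) λ S →
        (ℕ→ℚ ∣ S ∣ ≤∛ ((((ℕ→ℚ (m + n) · δ) /ℕ (r * r * n)) · ℕ→ℚ (m * m * m))))
      × (∀ x → x ∉ S →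
           (avgDegX G - ℕ→ℚ (degX G x))
             <∛ (((ℕ→ℚ (m + n) · δ) /ℕ (r * r * n)) · ℕ→ℚ (n * n * n))))
  × -- (b) exceptional set T ⊆ Y of size ≤ β^{1/3} n
    (Σ (Subset n) λ T →
        (ℕ→ℚ ∣ T ∣ ≤∛ ((((ℕ→ℚ (m + n) · δ) /ℕ (r * r * m)) · ℕ→ℚ (n * n * n))))
      × (∀ y → y ∉ T →
           (avgDegY G - ℕ→ℚ (degY G y))
             <∛ (((ℕ→ℚ (m + n) · δ) /ℕ (r * r * m)) · ℕ→ℚ (m * m * m)))))
lemma11 r hr δ hδ m n hm hmn G hE = case heavy-or-light G r of λ
  { (inj₁ (x , y , xy , heavy)) → inj₁ (double-star G r≥1 x y xy heavy)
  ; (inj₂ light) → inj₂ ( concentrated-degrees (degX G) (degY G) r≥1 hm hn δ hδ α α-def dense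
                            (handshake G) (light-degree-sums G {r} light)
                        ,′ concentrated-degrees (degY G) (degX G) r≥1 hn hm δ hδ β β-def denseᵀ
                            (sym (handshake G)) (light-degree-sumsᵀ G {r} light))
  }
  -- (the non-dependent pair _,′_ is used because elaborating the dependent
  -- pair against the two large Σ-types is extremely slow)
  where
  r≥1 : 1 ≤ r
  r≥1 = ℕ.≤-trans (ℕ.n≤1+n 1) hr
  hn : 1 ≤ n
  hn = ℕ.≤-trans hm hmn
  r²≥1 : ∀ {k} → 1 ≤ k → 1 ≤ r * r * k
  r²≥1 k≥1 = ℕ.*-mono-≤ (ℕ.*-mono-≤ r≥1 r≥1) k≥1
  α β : ℚ
  α = (ℕ→ℚ (m + n) · δ) /ℕ (r * r * n)
  β = (ℕ→ℚ (m + n) · δ) /ℕ (r * r * m)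
  α-def : α · ℕ→ℚ (r * r * n) ≡ ℕ→ℚ (m + n) · δ
  α-def = /ℕ-cancel (r²≥1 hn) _
  β-def : β · ℕ→ℚ (r * r * m) ≡ ℕ→ℚ (n + m) · δ
  β-def = trans (/ℕ-cancel (r²≥1 hm) _) (cong (λ k → ℕ→ℚ k · δ) (ℕ.+-comm m n))
  dense : (1ℚ - δ) · ℕ→ℚ (m * n) ≤ℚ ℕ→ℚ (e G) · ℕ→ℚ r
  dense = ≤-/ℕ r≥1 hE
  denseᵀ : (1ℚ - δ) · ℕ→ℚ (n * m) ≤ℚ ℕ→ℚ (Vec.sum (tabulate (degY G))) · ℕ→ℚ r
  denseᵀ = subst₂ (λ k E → (1ℚ - δ) · ℕ→ℚ k ≤ℚ E · ℕ→ℚ r) (ℕ.*-comm m n) (sym (edges-from-Y G)) dense
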